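{- Let $m \ge 2$, $r \ge 1$, $s \ge 1$ be integers and let $Py(m,r,s)$ be the peony graph. Then $\operatorname{Z}(Py(m,r,s)) \ge m(r-1)+3$.
   Context: The peony graph $Py(m,r,s)$ has vertex set $\{c\} \cup \{u_i\}_{i=1}^m \cup \{v_{i,j,k} : i \in [m], j \in [r], k \in [s]\}$, where $[n]=\{1,\dots,n\}$ and indices $i$ are taken modulo $m$ (so $v_{0,j,k}=v_{m,j,k}$). Two distinct vertices $w,z$ are adjacent if and only if: $\{w,z\}=\{c,u_i\}$ for some $i$; $\{w,z\}=\{u_i,v_{i,j,1}\}$ for some $i,j$; $\{w,z\}=\{u_i,v_{i-1,j,s}\}$ for some $i,j$; or $\{w,z\}=\{v_{i,j,k},v_{i,j,k+1}\}$ for some $i,j$ and $k\in[s-1]$. Zero forcing: a blue vertex with exactly one white neighbor may color that neighbor blue; a zero forcing set is an initial blue set from which repeated application colors all vertices blue; $\operatorname{Z}(G)$ is the minimum size of a zero forcing set. -}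

module Defs where

open import Data.Nat using (ℕ; zero; suc)
open import Data.Fin using (Fin; toℕ)
open import Data.Product using (_×_; Σ; _,_)
open import Data.Sum using (_⊎_)
open import Data.List using (List)
open import Data.List.Membership.Propositional using (_∈_)
open import Relation.Binary.PropositionalEquality using (_≡_)
open import Relation.Nullary using (¬_)

-- Vertices of the peony graph Py(m,r,s).  Indices are 0-based:
-- u i (i : Fin m) is u_{i+1}, v i j k is v_{i+1,j+1,k+1}.
data PyV (m r s : ℕ) : Set where
  c : PyV m r s
  u : Fin m → PyV m r s
  v : Fin m → Fin r → Fin s → PyV m r s

CycSucc : {m : ℕ} → Fin m → Fin m → Set
CycSucc {m} i i' = (suc (toℕ i) ≡ toℕ i') ⊎ ((suc (toℕ i) ≡ m) × (toℕ i' ≡ 0))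

data PyEdge (m r s : ℕ) : PyV m r s → PyV m r s → Set where
  e-cu   : (i : Fin m) → PyEdge m r s c (u i)
  e-uv₁  : (i : Fin m) (j : Fin r) (k : Fin s) → toℕ k ≡ 0 →
           PyEdge m r s (u i) (v i j k)
  -- {u_{i'}, v_{i,j,s}} with i' = i+1 mod m, i.e. {u_i, v_{i-1,j,s}}
  e-uvₛ  : (i i' : Fin m) → CycSucc i i' → (j : Fin r) (k : Fin s) →
           suc (toℕ k) ≡ s → PyEdge m r s (u i') (v i j k)
  e-vv   : (i : Fin m) (j : Fin r) (k k' : Fin s) → toℕ k' ≡ suc (toℕ k) →
           PyEdge m r s (v i j k) (v i j k')

PyAdj : (m r s : ℕ) → PyV m r s → PyV m r s → Set
PyAdj m r s w z = PyEdge m r s w z ⊎ PyEdge m r s z w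

-- A blue vertex w forces its neighbour z when every other neighbour of w is blue.
-- (This inductive closure is exactly the final colouring of the forcing process,
-- since the colour-change rule is monotone.)
data Blue {V : Set} (Adj : V → V → Set) (S : List V) : V → Set where
  initial : ∀ {z} → z ∈ S → Blue Adj S z
  force   : ∀ {w z} → Blue Adj S w → Adj w z →
            (∀ y → Adj w y → ¬ (y ≡ z) → Blue Adj S y) →
            Blue Adj S z

IsZeroForcingSet : {V : Set} → (V → V → Set) → List V → Set
IsZeroForcingSet {V} Adj S = ∀ (z : V) → Blue Adj S z

{-# OPTIONS --safe #-}
-- A fort is a set F of vertices such that every vertex outside F with a neighbour in F has two
-- neighbours in F. No vertex of F can be forced first, so a zero forcing set S meets every
-- nonempty fort. Call the r paths v_{i,j,1..s} with fixed i the sector i. Two paths of one sector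
-- avoided by S form a fort, so S meets all but at most one path of each sector; choosing a vertex
-- of S on each met path and skipping one path per sector gives m(r-1) distinct vertices. The unmet
-- paths of all sectors form a fort if every sector has one, and if c ∉ S, c together with them is
-- a fort unless two consecutive sectors have all paths met. Either way S has two more chosen
-- vertices: c, or the vertex chosen on the skipped path of a sector whose paths are all met.
-- Finally, Py has minimum degree 2, so the complement of an independent set is a fort; hence S
-- contains an edge, and every edge contains a u_i or a vertex not chosen on its path.
module Submission where

open import Defs
open import Data.Nat using (ℕ; zero; suc; _≤_; _+_; _*_; _∸_; s≤s; z≤n; _≤?_)
open import Data.Nat.Properties using (+-comm; 1+n≢n; m≢1+n+m)
open import Data.Fin as Fin using (Fin; zero; suc; toℕ; fromℕ; inject₁; punchIn; remQuot)
open import Data.Fin.Properties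
  using (toℕ-fromℕ; toℕ-inject₁; any?; all?; ¬∀⟶∃¬; punchInᵢ≢i; punchIn-injective; injective⇒≤; *↔×)
open import Data.Vec.Functional using (_∷_)
open import Data.Product using (_×_; _,_; proj₁; proj₂; ∃-syntax; Σ-syntax)
open import Data.Sum using (_⊎_; inj₁; inj₂; swap)
open import Data.Empty using (⊥; ⊥-elim)
open import Data.Unit using (⊤; tt)
open import Data.List using (List; length)
open import Data.List.Membership.Propositional using (_∈_; _∉_)
open import Data.List.Membership.Setoid.Properties using (index-injective)
open import Function using (_∘_; id)
open import Function.Bundles using (Injection)
open import Function.Definitions using (Injective)
open import Function.Properties.Inverse using (↔⇒↣)
open import Relation.Binary.Definitions using (DecidableEquality)
open import Relation.Binary.PropositionalEquality using (_≡_; _≢_; refl; sym; trans; cong; subst; setoid)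
open import Relation.Nullary using (¬_; Dec; yes; no)
open import Relation.Nullary.Decidable using (decidable-stable; map′; _×-dec_; ¬?)

module _ {V : Set} (Adj : V → V → Set) where

  record TwoNeighboursIn (F : V → Set) (w : V) : Set where
    constructor twoNeighbours
    field
      {y₁ y₂}  : V
      distinct : y₁ ≢ y₂
      adj₁     : Adj w y₁
      adj₂     : Adj w y₂
      in₁      : F y₁
      in₂      : F y₂

  IsFort : (V → Set) → Set
  IsFort F = ∀ {w z} → ¬ F w → F z → Adj w z → TwoNeighboursIn F w

  MinDegree≥2 : Set
  MinDegree≥2 = ∀ w → TwoNeighboursIn (λ _ → ⊤) w

  Independent : List V → Set
  Independent S = ∀ {x y} → Adj x y → x ∈ S → y ∈ S → ⊥

module _ {V : Set} {Adj : V → V → Set} (_≟_ : DecidableEquality V) {S : List V} where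

  blue-avoids-fort : ∀ {F z} → IsFort Adj F → (∀ {x} → x ∈ S → ¬ F x) → Blue Adj S z → ¬ F z
  blue-avoids-fort fort S∩F≡∅ (initial z∈S) = S∩F≡∅ z∈S
  blue-avoids-fort {z = z} fort S∩F≡∅ (force w-blue w~z others-blue) Fz
    with fort (blue-avoids-fort fort S∩F≡∅ w-blue) Fz w~z
  ... | twoNeighbours {y₁} {y₂} y₁≢y₂ w~y₁ w~y₂ Fy₁ Fy₂ with y₁ ≟ z
  ...   | yes refl = blue-avoids-fort fort S∩F≡∅ (others-blue y₂ w~y₂ (y₁≢y₂ ∘ sym)) Fy₂
  ...   | no y₁≢z  = blue-avoids-fort fort S∩F≡∅ (others-blue y₁ w~y₁ y₁≢z) Fy₁

  zeroForcingSet-meets-fort : ∀ {F} → IsZeroForcingSet Adj S → IsFort Adj F → ∀ {x} → F x →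
                              ¬ (∀ {y} → y ∈ S → ¬ F y)
  zeroForcingSet-meets-fort zfs fort Fx S∩F≡∅ = blue-avoids-fort fort S∩F≡∅ (zfs _) Fx

  complement-of-independent-isFort : MinDegree≥2 Adj → Independent Adj S → IsFort Adj (_∉ S)
  complement-of-independent-isFort δ≥2 indep {w} ¬w∉S _ _ =
    twoNeighbours distinct adj₁ adj₂ (outside adj₁) (outside adj₂)
    where
    open TwoNeighboursIn (δ≥2 w)
    outside : ∀ {y} → Adj w y → y ∉ S
    outside w~y y∈S = ¬w∉S λ w∈S → indep w~y w∈S y∈S

  zeroForcingSet-not-independent : MinDegree≥2 Adj → V → IsZeroForcingSet Adj S → ¬ Independent Adj S
  zeroForcingSet-not-independent δ≥2 x zfs indep =
    ¬¬∈S x λ x∈S → ¬¬∈S y₁ λ y₁∈S → indep adj₁ x∈S y₁∈S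
    where
    open TwoNeighboursIn (δ≥2 x)
    ¬¬∈S : ∀ y → ¬ y ∉ S
    ¬¬∈S y = blue-avoids-fort (complement-of-independent-isFort δ≥2 indep)
                              (λ y∈S y∉S → y∉S y∈S) (zfs y)

module _ {A : Set} where

  all-∷ : ∀ {n} (P : A → Set) {x} {f : Fin n → A} → P x → (∀ i → P (f i)) → ∀ i → P ((x ∷ f) i)
  all-∷ _ px _  zero    = px
  all-∷ _ _  pf (suc i) = pf i

  ∷-injective : ∀ {n x} {f : Fin n → A} → (∀ i → f i ≢ x) → Injective _≡_ _≡_ f →
                Injective _≡_ _≡_ (x ∷ f)
  ∷-injective x∉f f-inj {zero}  {zero}  _  = refl
  ∷-injective x∉f f-inj {zero}  {suc j} eq = ⊥-elim (x∉f j (sym eq))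
  ∷-injective x∉f f-inj {suc i} {zero}  eq = ⊥-elim (x∉f i eq)
  ∷-injective x∉f f-inj {suc i} {suc j} eq = cong suc (f-inj eq)

  injective⇒≤length : ∀ {n} {S : List A} (f : Fin n → A) → Injective _≡_ _≡_ f → (∀ i → f i ∈ S) →
                      n ≤ length S
  injective⇒≤length f f-inj f∈S =
    injective⇒≤ λ eq → f-inj (index-injective (setoid A) (f∈S _) (f∈S _) eq)

first-or-predecessor : ∀ {n} (k : Fin n) → toℕ k ≡ 0 ⊎ Σ[ k′ ∈ Fin n ] toℕ k ≡ suc (toℕ k′)
first-or-predecessor zero    = inj₁ refl
first-or-predecessor (suc k) = inj₂ (inject₁ k , cong suc (sym (toℕ-inject₁ k)))

last-or-successor : ∀ {n} (k : Fin n) → suc (toℕ k) ≡ n ⊎ Σ[ k′ ∈ Fin n ] toℕ k′ ≡ suc (toℕ k)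
last-or-successor {suc zero}    zero    = inj₁ refl
last-or-successor {suc (suc n)} zero    = inj₂ (suc zero , refl)
last-or-successor               (suc k) with last-or-successor k
... | inj₁ k≡last       = inj₁ (cong suc k≡last)
... | inj₂ (k′ , k′≡1+k) = inj₂ (suc k′ , cong suc k′≡1+k)

predecessor≢successor : ∀ {n} {k k₋ k₊ : Fin n} →
                        toℕ k ≡ suc (toℕ k₋) → toℕ k₊ ≡ suc (toℕ k) → k₋ ≢ k₊
predecessor≢successor {k₋ = k₋} k≡1+k₋ k₊≡1+k refl =
  m≢1+n+m (toℕ k₋) (trans k₊≡1+k (cong suc k≡1+k₋))

private
  variable
    m r s : ℕ

cycPredecessor : (i : Fin (suc m)) → ∃[ p ] CycSucc p i
cycPredecessor zero    = fromℕ _ , inj₂ (cong suc (toℕ-fromℕ _) , refl)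
cycPredecessor (suc i) = inject₁ i , inj₁ (cong suc (toℕ-inject₁ i))

cycSuccessor : (i : Fin (suc m)) → ∃[ i′ ] CycSucc i i′
cycSuccessor i with last-or-successor i
... | inj₁ i≡last        = zero , inj₂ (i≡last , refl)
... | inj₂ (i′ , i′≡1+i) = i′ , inj₁ (sym i′≡1+i)

cycSucc⇒≢ : ∀ {i i′ : Fin (2 + m)} → CycSucc i i′ → i ≢ i′
cycSucc⇒≢ (inj₁ 1+i≡i)        refl = 1+n≢n 1+i≡i
cycSucc⇒≢ (inj₂ (1+i≡m , i≡0)) refl with trans (sym 1+i≡m) (cong suc i≡0)
... | ()

u-injective : ∀ {i i′} → _≡_ {A = PyV m r s} (u i) (u i′) → i ≡ i′
u-injective refl = refl

v-injective : ∀ {i i′ j j′ k k′} → _≡_ {A = PyV m r s} (v i j k) (v i′ j′ k′) →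
              i ≡ i′ × j ≡ j′ × k ≡ k′
v-injective refl = refl , refl , refl

_≟_ : DecidableEquality (PyV m r s)
c       ≟ c          = yes refl
c       ≟ u _        = no λ ()
c       ≟ v _ _ _    = no λ ()
u _     ≟ c          = no λ ()
u i     ≟ u i′       = map′ (cong u) u-injective (i Fin.≟ i′)
u _     ≟ v _ _ _    = no λ ()
v _ _ _ ≟ c          = no λ ()
v _ _ _ ≟ u _        = no λ ()
v i j k ≟ v i′ j′ k′ =
  map′ (λ { (refl , refl , refl) → refl }) v-injective
       (i Fin.≟ i′ ×-dec j Fin.≟ j′ ×-dec k Fin.≟ k′)

u~first : ∀ {i j} → PyAdj m r (suc s) (u i) (v i j zero)
u~first = inj₁ (e-uv₁ _ _ _ refl)

u~last : ∀ {i i′ j} → CycSucc i i′ → PyAdj m r (suc s) (u i′) (v i j (fromℕ s))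
u~last i→i′ = inj₁ (e-uvₛ _ _ i→i′ _ _ (cong suc (toℕ-fromℕ _)))

c≁v : ∀ {i j k} → ¬ PyAdj m r s c (v i j k)
c≁v (inj₁ ())
c≁v (inj₂ ())

u~v-anyPath : ∀ {a i j k} → PyAdj m r s (u a) (v i j k) → ∀ j′ → PyAdj m r s (u a) (v i j′ k)
u~v-anyPath (inj₁ (e-uv₁ i _ k k≡0))           j′ = inj₁ (e-uv₁ i j′ k k≡0)
u~v-anyPath (inj₁ (e-uvₛ i a i→a _ k k≡last)) j′ = inj₁ (e-uvₛ i a i→a j′ k k≡last)
u~v-anyPath (inj₂ ())

v~v⇒samePath : ∀ {i i′ j j′ k k′} → PyAdj m r s (v i j k) (v i′ j′ k′) → i ≡ i′ × j ≡ j′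
v~v⇒samePath (inj₁ (e-vv _ _ _ _ _)) = refl , refl
v~v⇒samePath (inj₂ (e-vv _ _ _ _ _)) = refl , refl

minDegree≥2 : MinDegree≥2 (PyAdj (2 + m) (suc r) (suc s))
minDegree≥2 c     = twoNeighbours (λ ()) (inj₁ (e-cu zero)) (inj₁ (e-cu (suc zero))) tt tt
minDegree≥2 (u a) = twoNeighbours (λ ()) (inj₂ (e-cu a)) (u~first {j = zero}) tt tt
minDegree≥2 (v i j k) with first-or-predecessor k | last-or-successor k | cycSuccessor i
... | inj₁ k≡0 | inj₁ k≡last | i′ , i→i′ =
  twoNeighbours (cycSucc⇒≢ i→i′ ∘ u-injective)
    (inj₂ (e-uv₁ i j k k≡0)) (inj₂ (e-uvₛ i i′ i→i′ j k k≡last)) tt tt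
... | inj₁ k≡0 | inj₂ (k₊ , k₊≡1+k) | _ =
  twoNeighbours (λ ()) (inj₂ (e-uv₁ i j k k≡0)) (inj₁ (e-vv i j k k₊ k₊≡1+k)) tt tt
... | inj₂ (k₋ , k≡1+k₋) | inj₁ k≡last | i′ , i→i′ =
  twoNeighbours (λ ()) (inj₂ (e-vv i j k₋ k k≡1+k₋)) (inj₂ (e-uvₛ i i′ i→i′ j k k≡last)) tt tt
... | inj₂ (k₋ , k≡1+k₋) | inj₂ (k₊ , k₊≡1+k) | _ =
  twoNeighbours (predecessor≢successor k≡1+k₋ k₊≡1+k ∘ proj₂ ∘ proj₂ ∘ v-injective)
    (inj₂ (e-vv i j k₋ k k≡1+k₋)) (inj₁ (e-vv i j k k₊ k₊≡1+k)) tt tt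

PathUnion : Set → (Fin m → Fin r → Set) → PyV m r s → Set
PathUnion C P c         = C
PathUnion C P (u _)     = ⊥
PathUnion C P (v i j _) = P i j

pathUnion-isFort : ∀ {C} {P : Fin m → Fin r → Set} → let F = PathUnion {s = s} C P in
  (C → ∀ a → TwoNeighboursIn (PyAdj m r s) F (u a)) →
  (∀ {a i j k} → P i j → PyAdj m r s (u a) (v i j k) → TwoNeighboursIn (PyAdj m r s) F (u a)) →
  IsFort (PyAdj m r s) F
pathUnion-isFort atC atP {c}       {c}       _ _   (inj₁ ())
pathUnion-isFort atC atP {c}       {c}       _ _   (inj₂ ())
pathUnion-isFort atC atP {c}       {u _}     _ ()  _
pathUnion-isFort atC atP {c}       {v _ _ _} _ _   c~v = ⊥-elim (c≁v c~v)
pathUnion-isFort atC atP {u a}     {c}       _ Fc  _   = atC Fc a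
pathUnion-isFort atC atP {u a}     {u _}     _ ()  _
pathUnion-isFort atC atP {u a}     {v _ _ _} _ Pij a~v = atP Pij a~v
pathUnion-isFort atC atP {v _ _ _} {c}       _ _   v~c = ⊥-elim (c≁v (swap v~c))
pathUnion-isFort atC atP {v _ _ _} {u _}     _ ()  _
pathUnion-isFort atC atP {v _ _ _} {v _ _ _} ¬Fw Fz w~z with v~v⇒samePath w~z
... | refl , refl = ⊥-elim (¬Fw Fz)

module ZeroForcingSet {m r s : ℕ} (S : List (PyV (2 + m) (suc r) (suc s)))
                      (zfs : IsZeroForcingSet (PyAdj (2 + m) (suc r) (suc s)) S) where

  open import Data.List.Membership.DecPropositional (_≟_ {2 + m} {suc r} {suc s}) using (_∈?_)

  private
    V   = PyV (2 + m) (suc r) (suc s)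
    Adj = PyAdj (2 + m) (suc r) (suc s)

  PathMet : Fin (2 + m) → Fin (suc r) → Set
  PathMet i j = ∃[ k ] v i j k ∈ S

  pathMet? : ∀ i j → Dec (PathMet i j)
  pathMet? i j = any? λ k → v i j k ∈? S

  SectorMet : Fin (2 + m) → Set
  SectorMet i = ∀ j → PathMet i j

  sectorMet? : ∀ i → Dec (SectorMet i)
  sectorMet? i = all? (pathMet? i)

  unmetPath : ∀ {i} → ¬ SectorMet i → ∃[ j ] ¬ PathMet i j
  unmetPath {i} = ¬∀⟶∃¬ _ _ (pathMet? i)

  avoids-unmetPaths : ∀ {C} {P : Fin (2 + m) → Fin (suc r) → Set} → (C → c ∉ S) →
                      (∀ {i j} → P i j → ¬ PathMet i j) → ∀ {x} → x ∈ S → ¬ PathUnion C P x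
  avoids-unmetPaths c∉S _ {c}       c∈S     C   = c∉S C c∈S
  avoids-unmetPaths _   _ {u _}     _       ()
  avoids-unmetPaths _   P⇒¬met {v _ _ k} v∈S Pij = P⇒¬met Pij (k , v∈S)

  atMostOneUnmetPath : ∀ {i j₁ j₂} → ¬ PathMet i j₁ → ¬ PathMet i j₂ → j₁ ≡ j₂
  atMostOneUnmetPath {i} {j₁} {j₂} ¬met₁ ¬met₂ = decidable-stable (j₁ Fin.≟ j₂) λ j₁≢j₂ →
    zeroForcingSet-meets-fort _≟_ zfs (fort j₁≢j₂) {v i j₁ zero} (refl , ¬met₁)
      (avoids-unmetPaths (λ ()) proj₂)
    where
    fort : j₁ ≢ j₂ → IsFort Adj (PathUnion ⊥ λ i′ j → i′ ≡ i × ¬ PathMet i′ j)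
    fort j₁≢j₂ = pathUnion-isFort (λ ()) λ { (refl , _) a~v →
      twoNeighbours (j₁≢j₂ ∘ proj₁ ∘ proj₂ ∘ v-injective)
        (u~v-anyPath a~v j₁) (u~v-anyPath a~v j₂) (refl , ¬met₁) (refl , ¬met₂) }

  skippedPath : ∀ i → ∃[ j₀ ] (∀ {j} → j ≢ j₀ → PathMet i j)
  skippedPath i with any? (λ j → ¬? (pathMet? i j))
  ... | yes (j₀ , ¬met₀) = j₀ , λ {j} j≢j₀ →
    decidable-stable (pathMet? i j) λ ¬met → j≢j₀ (atMostOneUnmetPath ¬met ¬met₀)
  ... | no ∄unmet = zero , λ {j} _ → decidable-stable (pathMet? i j) λ ¬met → ∄unmet (j , ¬met)

  someSectorMet : ∃[ i ] SectorMet i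
  someSectorMet with any? sectorMet?
  ... | yes met = met
  ... | no ∄met =
    let j , ¬met = unmet zero in
    ⊥-elim (zeroForcingSet-meets-fort _≟_ zfs fort {v zero j zero} ¬met (avoids-unmetPaths (λ ()) id))
    where
    unmet : ∀ i → ∃[ j ] ¬ PathMet i j
    unmet i = unmetPath λ met → ∄met (i , met)
    fort : IsFort Adj (PathUnion ⊥ λ i j → ¬ PathMet i j)
    fort = pathUnion-isFort (λ ()) λ {a} _ _ →
      let p , p→a = cycPredecessor a
          j , ¬met = unmet a
          j′ , ¬met′ = unmet p
      in twoNeighbours (cycSucc⇒≢ p→a ∘ sym ∘ proj₁ ∘ v-injective) u~first (u~last p→a) ¬met ¬met′

  ConsecutiveSectorsMet : Set
  ConsecutiveSectorsMet = ∃[ p ] ∃[ i ] CycSucc p i × SectorMet p × SectorMet i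

  centre-or-consecutiveSectorsMet : c ∈ S ⊎ ConsecutiveSectorsMet
  centre-or-consecutiveSectorsMet with c ∈? S
  ... | yes c∈S = inj₁ c∈S
  ... | no c∉S with any? (λ i → sectorMet? (proj₁ (cycPredecessor i)) ×-dec sectorMet? i)
  ...   | yes (i , met-p , met-i) = inj₂ (_ , i , proj₂ (cycPredecessor i) , met-p , met-i)
  ...   | no ∄consecutive =
    ⊥-elim (zeroForcingSet-meets-fort _≟_ zfs fort {c} tt (avoids-unmetPaths (λ _ → c∉S) id))
    where
    unmetNeighbour : ∀ a → ∃[ i ] ∃[ j ] ∃[ k ] ¬ PathMet i j × Adj (u a) (v i j k)
    unmetNeighbour a with sectorMet? a
    ... | no ¬met-a = let j , ¬met = unmetPath ¬met-a in a , j , zero , ¬met , u~first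
    ... | yes met-a =
      let p , p→a = cycPredecessor a
          j , ¬met = unmetPath λ met-p → ∄consecutive (a , met-p , met-a)
      in p , j , fromℕ s , ¬met , u~last p→a
    fort : IsFort Adj (PathUnion ⊤ λ i j → ¬ PathMet i j)
    fort = pathUnion-isFort
      (λ _ a → let _ , _ , _ , ¬met , a~v = unmetNeighbour a in
               twoNeighbours (λ ()) (inj₂ (e-cu a)) a~v tt ¬met)
      λ ¬met a~v → twoNeighbours (λ ()) (inj₂ (e-cu _)) a~v tt ¬met

  -- For an unmet path, rep i j is an arbitrary junk index.
  rep : Fin (2 + m) → Fin (suc r) → Fin (suc s)
  rep i j with pathMet? i j
  ... | yes (k , _) = k
  ... | no _        = zero

  rep-∈ : ∀ {i j} → PathMet i j → v i j (rep i j) ∈ S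
  rep-∈ {i} {j} met with pathMet? i j
  ... | yes (_ , v∈S) = v∈S
  ... | no ¬met       = ⊥-elim (¬met met)

  -- c counts as a representative so that a non-representative differs from every spare one.
  Representative : V → Set
  Representative c         = ⊤
  Representative (u _)     = ⊥
  Representative (v i j k) = k ≡ rep i j

  edge-nonRepresentative : ∀ {x y} → Adj x y → x ∈ S → y ∈ S → ∃[ t ] t ∈ S × ¬ Representative t
  edge-nonRepresentative (inj₁ e) x∈S y∈S = edge e x∈S y∈S
    where
    edge : ∀ {x y} → PyEdge (2 + m) (suc r) (suc s) x y → x ∈ S → y ∈ S →
           ∃[ t ] t ∈ S × ¬ Representative t
    edge (e-cu _)              _   u∈S  = _ , u∈S , λ ()
    edge (e-uv₁ _ _ _ _)       u∈S _    = _ , u∈S , λ ()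
    edge (e-uvₛ _ _ _ _ _ _)   u∈S _    = _ , u∈S , λ ()
    edge (e-vv i j k k′ k′≡1+k) k∈S k′∈S with k Fin.≟ rep i j
    ... | no k≢rep  = _ , k∈S , k≢rep
    ... | yes k≡rep = _ , k′∈S , λ k′≡rep →
      1+n≢n (trans (sym k′≡1+k) (cong toℕ (trans k′≡rep (sym k≡rep))))
  edge-nonRepresentative (inj₂ e) x∈S y∈S = edge-nonRepresentative (inj₁ e) y∈S x∈S

  skip : Fin (2 + m) → Fin (suc r)
  skip i = proj₁ (skippedPath i)

  unskipped : Fin (2 + m) × Fin r → V
  unskipped (i , a) = v i (punchIn (skip i) a) (rep i (punchIn (skip i) a))

  unskipped-injective : Injective _≡_ _≡_ unskipped
  unskipped-injective {i , a} {_ , b} eq with v-injective eq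
  ... | refl , punchIn≡ , _ = cong (i ,_) (punchIn-injective (skip i) a b punchIn≡)

  unskipped-∈ : ∀ p → unskipped p ∈ S
  unskipped-∈ (i , a) = rep-∈ (proj₂ (skippedPath i) (punchInᵢ≢i (skip i) a))

  unskipped-representative : ∀ p → Representative (unskipped p)
  unskipped-representative _ = refl

  SpareRepresentative : V → Set
  SpareRepresentative e = e ∈ S × Representative e × (∀ p → unskipped p ≢ e)

  centre-spare : c ∈ S → SpareRepresentative c
  centre-spare c∈S = c∈S , tt , λ _ ()

  skipped-spare : ∀ {i} → SectorMet i → SpareRepresentative (v i (skip i) (rep i (skip i)))
  skipped-spare {i} met = rep-∈ (met _) , refl , unlisted
    where
    unlisted : ∀ p → unskipped p ≢ v i (skip i) (rep i (skip i))
    unlisted (_ , a) eq with v-injective eq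
    ... | refl , punchIn≡skip , _ = punchInᵢ≢i (skip i) a punchIn≡skip

  twoSpareRepresentatives : ∃[ e₀ ] ∃[ e₁ ] SpareRepresentative e₀ × SpareRepresentative e₁ × e₀ ≢ e₁
  twoSpareRepresentatives with centre-or-consecutiveSectorsMet
  ... | inj₁ c∈S = let _ , met = someSectorMet in
                   _ , _ , centre-spare c∈S , skipped-spare met , λ ()
  ... | inj₂ (_ , _ , p→i , met-p , met-i) =
    _ , _ , skipped-spare met-p , skipped-spare met-i , cycSucc⇒≢ p→i ∘ proj₁ ∘ v-injective

  lowerBound : ∀ {e₀ e₁ t} → SpareRepresentative e₀ → SpareRepresentative e₁ → e₀ ≢ e₁ →
               t ∈ S → ¬ Representative t → (2 + m) * r + 3 ≤ length S
  lowerBound {e₀} {e₁} {t} (e₀∈S , rep₀ , new₀) (e₁∈S , rep₁ , new₁) e₀≢e₁ t∈S t-nonRep =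
    subst (_≤ length S) (+-comm 3 _) (injective⇒≤length family family-injective family-∈)
    where
    listed : Fin ((2 + m) * r) → V
    listed = unskipped ∘ remQuot r
    listed-injective : Injective _≡_ _≡_ listed
    listed-injective = Injection.injective (↔⇒↣ *↔×) ∘ unskipped-injective
    listed-representative : ∀ x → Representative (listed x)
    listed-representative = unskipped-representative ∘ remQuot r
    ≢t : ∀ {e} → Representative e → e ≢ t
    ≢t rep-e e≡t = t-nonRep (subst Representative e≡t rep-e)
    family : Fin (3 + (2 + m) * r) → V
    family = t ∷ e₁ ∷ e₀ ∷ listed
    family-injective : Injective _≡_ _≡_ family
    family-injective =
      ∷-injective (all-∷ (_≢ t) (≢t rep₁) (all-∷ (_≢ t) (≢t rep₀) (≢t ∘ listed-representative)))
        (∷-injective (all-∷ (_≢ e₁) e₀≢e₁ (new₁ ∘ remQuot r))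
          (∷-injective (new₀ ∘ remQuot r) listed-injective))
    family-∈ : ∀ x → family x ∈ S
    family-∈ = all-∷ (_∈ S) t∈S (all-∷ (_∈ S) e₁∈S (all-∷ (_∈ S) e₀∈S
                 (unskipped-∈ ∘ remQuot r)))

mainTheorem3 : (m r s : ℕ) → 2 ≤ m → 1 ≤ r → 1 ≤ s →
    (S : List (PyV m r s)) → IsZeroForcingSet (PyAdj m r s) S →
    m * (r ∸ 1) + 3 ≤ length S
mainTheorem3 (suc (suc m)) (suc r) (suc s) (s≤s (s≤s z≤n)) (s≤s z≤n) (s≤s z≤n) S zfs =
  -- The bound is decidable, so it suffices to show that S would otherwise be independent.
  decidable-stable (_ ≤? _) λ tooSmall →
    zeroForcingSet-not-independent _≟_ minDegree≥2 c zfs λ x~y x∈S y∈S →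
      let t , t∈S , t-nonRep = edge-nonRepresentative x~y x∈S y∈S
          _ , _ , spare₀ , spare₁ , e₀≢e₁ = twoSpareRepresentatives
      in tooSmall (lowerBound spare₀ spare₁ e₀≢e₁ t∈S t-nonRep)
  where open ZeroForcingSet S zfs
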